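{- For a graph $G$, $\operatorname{NRel}(G,p) = \operatorname{NCRel}(G,p)$ as polynomials in $p$ if and only if $G$ is chordal.
   Context: All graphs are finite, simple and undirected. A graph is chordal if it has no induced cycle of length greater than $3$. A graph is cop-win if, in the game of Cops and Robber with one cop (cop places, then robber places, then they alternately move to an adjacent vertex or stay put; the cop wins on occupying the robber's vertex), the cop can guarantee capture. For $G$ of order $n$, $S_i(G)$ is the number of $i$-subsets of $V(G)$ inducing a connected subgraph and $W_i(G)$ the number inducing a cop-win subgraph; $\operatorname{NRel}(G,p)=\sum_{i=1}^n S_i(G)(1-p)^{n-i}p^i$ and $\operatorname{NCRel}(G,p)=\sum_{i=1}^n W_i(G)(1-p)^{n-i}p^i$. -}

module Defs where

open import Data.Bool using (Bool; true; false)
open import Data.Nat as ℕ using (ℕ; zero; suc; _≤_; _∸_)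
open import Data.Fin using (Fin; toℕ)
open import Data.Fin.Subset using (Subset; _∈_; ∣_∣)
open import Data.List using (List; length)
open import Data.List.Relation.Unary.Unique.Propositional using (Unique)
open import Data.List.Membership.Propositional renaming (_∈_ to _∈ₗ_)
open import Data.Product using (Σ; _×_; ∃; ∃-syntax)
open import Data.Sum using (_⊎_)
open import Data.Integer using (+_)
open import Data.Rational using (ℚ; 0ℚ; 1ℚ; _+_; _*_; _-_; _/_)
open import Relation.Binary.PropositionalEquality using (_≡_)
open import Relation.Nullary using (¬_)
open import Function using (_⇔_)
open import Function.Definitions using (Injective)

record Graph (n : ℕ) : Set where
  field
    adj   : Fin n → Fin n → Bool
    sym   : ∀ u v → adj u v ≡ adj v u
    irref : ∀ v → adj v v ≡ false

open Graph public

module _ {n : ℕ} (G : Graph n) where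

  Edge : Fin n → Fin n → Set
  Edge u v = adj G u v ≡ true

  ClosedNbr : Fin n → Fin n → Set
  ClosedNbr u v = (u ≡ v) ⊎ Edge u v

  data Reach (S : Subset n) : Fin n → Fin n → Set where
    here : ∀ {u} → u ∈ S → Reach S u u
    step : ∀ {u v w} → u ∈ S → Edge u v → Reach S v w → Reach S u w

  Connected : Subset n → Set
  Connected S = (∃[ v ] v ∈ S) × (∀ u v → u ∈ S → v ∈ S → Reach S u v)

  -- Cops and Robber on G[S]: CopForces S c r holds iff, with the cop on c,
  -- the robber on r and the cop to move, the cop can force capture.
  data CopForces (S : Subset n) : Fin n → Fin n → Set where
    caught : ∀ {c} → CopForces S c c
    move   : ∀ {c r} c' → c' ∈ S → ClosedNbr c c' →
             ((c' ≡ r) ⊎ (∀ r' → r' ∈ S → ClosedNbr r r' → CopForces S c' r')) →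
             CopForces S c r

  CopWin : Subset n → Set
  CopWin S = ∃[ c ] (c ∈ S × (∀ r → r ∈ S → CopForces S c r))

  CycAdj : (k : ℕ) → Fin k → Fin k → Set
  CycAdj k i j = (suc (toℕ i) ≡ toℕ j) ⊎ (suc (toℕ j) ≡ toℕ i)
               ⊎ ((toℕ i ≡ 0) × (suc (toℕ j) ≡ k))
               ⊎ ((toℕ j ≡ 0) × (suc (toℕ i) ≡ k))

  InducedCycle : ℕ → Set
  InducedCycle k = Σ (Fin k → Fin n) λ f →
    Injective _≡_ _≡_ f × (∀ i j → Edge (f i) (f j) ⇔ CycAdj k i j)

  Chordal : Set
  Chordal = ∀ k → 4 ≤ k → ¬ InducedCycle k

IsCount : {n : ℕ} → (Subset n → Set) → ℕ → Set
IsCount {n} P k = Σ (List (Subset n)) λ xs →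
  Unique xs × length xs ≡ k × (∀ s → (s ∈ₗ xs) ⇔ P s)

IsSCount : {n : ℕ} → Graph n → (ℕ → ℕ) → Set
IsSCount G S = ∀ i → IsCount (λ s → ∣ s ∣ ≡ i × Connected G s) (S i)

IsWCount : {n : ℕ} → Graph n → (ℕ → ℕ) → Set
IsWCount G W = ∀ i → IsCount (λ s → ∣ s ∣ ≡ i × CopWin G s) (W i)

ℕtoℚ : ℕ → ℚ
ℕtoℚ m = + m / 1

_^_ : ℚ → ℕ → ℚ
x ^ zero = 1ℚ
x ^ suc m = x * (x ^ m)

relSum : (n : ℕ) → (ℕ → ℕ) → ℚ → ℕ → ℚ
relSum n c p zero = 0ℚ
relSum n c p (suc m) =
  relSum n c p m + (ℕtoℚ (c (suc m)) * ((1ℚ - p) ^ (n ∸ suc m)) * (p ^ suc m))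

RelPoly : (n : ℕ) → (ℕ → ℕ) → ℚ → ℚ
RelPoly n c p = relSum n c p n

-- At p = ½ every weight (1 - p)^(n - i) p^i is positive. A cop-win subgraph is connected, so
-- W i ≤ S i for every i, and the polynomials agree exactly when S = W, i.e. when every connected
-- induced subgraph is cop-win.
-- An induced cycle of length at least 4 is connected but not cop-win: the robber can always step
-- out of the cop's closed neighbourhood. Conversely, in a chordal graph every connected induced
-- subgraph that is not a clique has a simplicial vertex (Dirac), which is dominated by each of its
-- neighbours; deleting a dominated vertex preserves connectivity, and a cop-win strategy for the
-- smaller subgraph lifts by chasing the image of the robber under the retraction onto it.

module Submission where

open import Defs
import Data.Bool as Bool
open import Data.Nat as ℕ using (ℕ; zero; suc; _∸_; _≤_; _<_; z≤n; s≤s)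
import Data.Nat.Properties as ℕₚ
import Data.Nat.Coprimality as Coprime
open import Data.Integer as ℤ using (+_)
import Data.Integer.Properties as ℤₚ
open import Data.Rational as ℚ using (ℚ; 1ℚ; mkℚ; Positive; *≤*; *<*)
import Data.Rational.Properties as ℚₚ
open import Data.List using (List; []; _∷_; length; filter; lookup)
open import Data.List.Properties using (filter-notAll)
open import Data.List.Relation.Unary.Any as Any using (Any)
open import Data.List.Relation.Unary.All as All using (All; []; _∷_)
open import Data.List.Relation.Unary.AllPairs using (_∷_)
open import Data.List.Relation.Unary.Unique.Propositional using (Unique)
open import Data.List.Membership.Propositional using () renaming (_∈_ to _∈ₗ_; _∉_ to _∉ₗ_)
open import Data.List.Membership.Propositional.Properties using (∈-filter⁺; ∈-lookup)
open import Data.List.Relation.Unary.All.Properties using (¬Any⇒All¬)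
open import Data.Fin as Fin using (Fin; zero; suc; toℕ; fromℕ<)
import Data.Fin.Properties as Finₚ
open import Data.Fin.Subset using (Subset; inside; outside; _∈_; _∉_; _⊆_; ⁅_⁆; _─_; _-_; ∣_∣)
import Data.Fin.Subset.Properties as Subsetₚ
open import Data.Vec as Vec using (_∷_; tabulate)
import Data.Vec.Properties as Vecₚ
open import Data.Product using (Σ; ∃; _×_; _,_; proj₁; proj₂)
open import Data.Sum as Sum using (_⊎_; inj₁; inj₂; [_,_])
open import Function using (_∘_; _⇔_; mk⇔; Equivalence)
open import Relation.Binary.Definitions using (DecidableEquality)
open import Relation.Binary.PropositionalEquality as ≡ using (_≡_; _≢_; refl)
open import Relation.Nullary using (¬_; ¬?; Dec; yes; no; does; contradiction)
open import Relation.Nullary.Decidable using (dec-true; _⊎-dec_; _×-dec_)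
open import Relation.Unary using (Decidable)
open import Induction.WellFounded using (Acc; acc)
open import Data.Nat.Induction using (<-wellFounded)

ℕtoℚ≡mkℚ : ∀ m → ℕtoℚ m ≡ mkℚ (+ m) 0 (Coprime.sym (Coprime.1-coprimeTo m))
ℕtoℚ≡mkℚ m = ℚₚ.normalize-coprime (Coprime.sym (Coprime.1-coprimeTo m))

ℕtoℚ-mono-≤ : ∀ {a b} → a ≤ b → ℕtoℚ a ℚ.≤ ℕtoℚ b
ℕtoℚ-mono-≤ {a} {b} a≤b rewrite ℕtoℚ≡mkℚ a | ℕtoℚ≡mkℚ b =
  *≤* (ℤₚ.*-monoʳ-≤-nonNeg (+ 1) (ℤ.+≤+ a≤b))

ℕtoℚ-mono-< : ∀ {a b} → a < b → ℕtoℚ a ℚ.< ℕtoℚ b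
ℕtoℚ-mono-< {a} {b} a<b rewrite ℕtoℚ≡mkℚ a | ℕtoℚ≡mkℚ b =
  *<* (ℤₚ.*-monoʳ-<-pos (+ 1) (ℤ.+<+ a<b))

^-pos : ∀ x .{{_ : Positive x}} m → Positive (x ^ m)
^-pos x zero    = _
^-pos x (suc m) = ℚₚ.pos*pos⇒pos x (x ^ m) {{^-pos x m}}

module _ {a b : ℕ} (x y : ℚ) .{{_ : Positive x}} .{{_ : Positive y}} where

  ℕtoℚ-*-*-mono-≤ : a ≤ b → ℕtoℚ a ℚ.* x ℚ.* y ℚ.≤ ℕtoℚ b ℚ.* x ℚ.* y
  ℕtoℚ-*-*-mono-≤ a≤b =
    ℚₚ.*-monoʳ-≤-nonNeg y {{ℚₚ.pos⇒nonNeg y}}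
      (ℚₚ.*-monoʳ-≤-nonNeg x {{ℚₚ.pos⇒nonNeg x}} (ℕtoℚ-mono-≤ a≤b))

  ℕtoℚ-*-*-mono-< : a < b → ℕtoℚ a ℚ.* x ℚ.* y ℚ.< ℕtoℚ b ℚ.* x ℚ.* y
  ℕtoℚ-*-*-mono-< a<b = ℚₚ.*-monoˡ-<-pos y (ℚₚ.*-monoˡ-<-pos x (ℕtoℚ-mono-< a<b))

module _ (n : ℕ) (p : ℚ) where

  relSum-cong : ∀ {c d} → (∀ i → c i ≡ d i) → ∀ m → relSum n c p m ≡ relSum n d p m
  relSum-cong c≡d zero    = refl
  relSum-cong c≡d (suc m) rewrite relSum-cong c≡d m | c≡d (suc m) = refl

  module _ .{{_ : Positive p}} .{{_ : Positive (1ℚ ℚ.- p)}} where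

    private
      term : ℕ → ℕ → ℚ
      term a i = ℕtoℚ a ℚ.* (1ℚ ℚ.- p) ^ (n ∸ i) ℚ.* p ^ i

      term-mono-≤ : ∀ i {a b} → a ≤ b → term a i ℚ.≤ term b i
      term-mono-≤ i = ℕtoℚ-*-*-mono-≤ _ _ {{^-pos (1ℚ ℚ.- p) (n ∸ i)}} {{^-pos p i}}

      term-mono-< : ∀ i {a b} → a < b → term a i ℚ.< term b i
      term-mono-< i = ℕtoℚ-*-*-mono-< _ _ {{^-pos (1ℚ ℚ.- p) (n ∸ i)}} {{^-pos p i}}

    module _ {c d : ℕ → ℕ} (c≤d : ∀ i → c i ≤ d i) where

      relSum-mono-≤ : ∀ m → relSum n c p m ℚ.≤ relSum n d p m
      relSum-mono-≤ zero    = ℚₚ.≤-refl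
      relSum-mono-≤ (suc m) = ℚₚ.+-mono-≤ (relSum-mono-≤ m) (term-mono-≤ (suc m) (c≤d (suc m)))

      relSum-mono-< : ∀ {k} → c k < d k → 1 ≤ k → ∀ m → k ≤ m → relSum n c p m ℚ.< relSum n d p m
      relSum-mono-< _ (s≤s z≤n) zero ()
      relSum-mono-< {k} ck<dk 1≤k (suc m) k≤1+m with k ℕₚ.≟ suc m
      ... | yes refl = ℚₚ.+-mono-≤-< (relSum-mono-≤ m) (term-mono-< (suc m) ck<dk)
      ... | no  k≢1+m = ℚₚ.+-mono-<-≤
        (relSum-mono-< ck<dk 1≤k m (ℕₚ.≤-pred (ℕₚ.≤∧≢⇒< k≤1+m k≢1+m)))
        (term-mono-≤ (suc m) (c≤d (suc m)))

module _ {A : Set} (_≟_ : DecidableEquality A) where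

  length-mono-⊆ : ∀ {xs ys : List A} → Unique xs → (∀ {a} → a ∈ₗ xs → a ∈ₗ ys) →
                  length xs ≤ length ys
  length-mono-⊆ {[]}     _            _     = z≤n
  length-mono-⊆ {a ∷ xs} {ys} (a∉xs ∷ u) xs⊆ys =
    ℕₚ.≤-trans (s≤s (length-mono-⊆ u xs⊆ys-a)) (filter-notAll (λ t → ¬? (t ≟ a)) ys a∈ys)
    where
    a∈ys : Any.Any (λ t → ¬ ¬ t ≡ a) ys
    a∈ys = Any.map (λ a≡t t≢a → t≢a (≡.sym a≡t)) (xs⊆ys (Any.here refl))
    xs⊆ys-a : ∀ {b} → b ∈ₗ xs → b ∈ₗ filter (λ t → ¬? (t ≟ a)) ys
    xs⊆ys-a b∈xs = ∈-filter⁺ (λ t → ¬? (t ≟ a)) (xs⊆ys (Any.there b∈xs))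
                     (λ b≡a → All.lookup a∉xs b∈xs (≡.sym b≡a))

  length-mono-⊂ : ∀ {xs ys : List A} {y} → Unique xs → (∀ {a} → a ∈ₗ xs → a ∈ₗ ys) →
                  y ∈ₗ ys → y ∉ₗ xs → length xs < length ys
  length-mono-⊂ u xs⊆ys y∈ys y∉xs = length-mono-⊆ (¬Any⇒All¬ _ y∉xs ∷ u) λ
    { (Any.here refl) → y∈ys ; (Any.there a∈xs) → xs⊆ys a∈xs }

Subset-≟ : ∀ {n} → DecidableEquality (Subset n)
Subset-≟ = Vecₚ.≡-dec Bool._≟_

module _ {n : ℕ} {P Q : Subset n → Set} (P⇒Q : ∀ s → P s → Q s) where

  IsCount-mono-≤ : ∀ {a b} → IsCount P a → IsCount Q b → a ≤ b
  IsCount-mono-≤ (xs , uxs , refl , xs≈P) (ys , _ , refl , ys≈Q) =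
    length-mono-⊆ Subset-≟ uxs λ {s} s∈xs →
      Equivalence.from (ys≈Q s) (P⇒Q s (Equivalence.to (xs≈P s) s∈xs))

  IsCount-mono-< : ∀ {a b t} → Q t → ¬ P t → IsCount P a → IsCount Q b → a < b
  IsCount-mono-< {t = t} Qt ¬Pt (xs , uxs , refl , xs≈P) (ys , _ , refl , ys≈Q) =
    length-mono-⊂ Subset-≟ uxs
      (λ {s} s∈xs → Equivalence.from (ys≈Q s) (P⇒Q s (Equivalence.to (xs≈P s) s∈xs)))
      (Equivalence.from (ys≈Q t) Qt) (λ t∈xs → ¬Pt (Equivalence.to (xs≈P t) t∈xs))

select : ∀ {n} {P : Fin n → Set} → Decidable P → Subset n
select P? = tabulate (λ v → does (P? v))

module _ {n} {P : Fin n → Set} (P? : Decidable P) where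

  ∈-select⁺ : ∀ {v} → P v → v ∈ select P?
  ∈-select⁺ {v} Pv = Vecₚ.lookup⇒[]= v _ (≡.trans (Vecₚ.lookup∘tabulate _ v) (dec-true (P? v) Pv))

  ∈-select⁻ : ∀ {v} → v ∈ select P? → P v
  ∈-select⁻ {v} v∈ with P? v | ≡.trans (≡.sym (Vecₚ.lookup∘tabulate _ v)) (Vecₚ.[]=⇒lookup v∈)
  ... | yes Pv | _  = Pv
  ... | no _   | ()

x∈p─q⇒x∉q : ∀ {n} {p q : Subset n} {x} → x ∈ p ─ q → x ∉ q
x∈p─q⇒x∉q {p = inside ∷ _} {outside ∷ _} Vec.here       ()
x∈p─q⇒x∉q {p = _ ∷ _}      {_ ∷ _}       (Vec.there x∈) (Vec.there x∈q) = x∈p─q⇒x∉q x∈ x∈q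

x∈p-y⇒x≢y : ∀ {n} {p : Subset n} {x y} → x ∈ p - y → x ≢ y
x∈p-y⇒x≢y {y = y} x∈ refl = x∈p─q⇒x∉q x∈ (Subsetₚ.x∈⁅x⁆ y)

p-x⊆p : ∀ {n} (p : Subset n) x → p - x ⊆ p
p-x⊆p p x = Subsetₚ.p─q⊆p p ⁅ x ⁆

CycAdjℕ : ℕ → ℕ → ℕ → Set
CycAdjℕ k x y = (suc x ≡ y) ⊎ (suc y ≡ x) ⊎ ((x ≡ 0) × (suc y ≡ k)) ⊎ ((y ≡ 0) × (suc x ≡ k))

CycNbrℕ : ℕ → ℕ → ℕ → Set
CycNbrℕ k x y = x ≡ y ⊎ CycAdjℕ k x y

CycAdjℕ? : ∀ k x y → Dec (CycAdjℕ k x y)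
CycAdjℕ? k x y = (suc x ℕₚ.≟ y) ⊎-dec (suc y ℕₚ.≟ x)
  ⊎-dec ((x ℕₚ.≟ 0) ×-dec (suc y ℕₚ.≟ k)) ⊎-dec ((y ℕₚ.≟ 0) ×-dec (suc x ℕₚ.≟ k))

Escape : ℕ → ℕ → ℕ → Set
Escape k x y = Σ ℕ λ y' → y' < k × CycNbrℕ k y y' × ¬ CycNbrℕ k x y'

-- A robber adjacent to the cop steps away from her; for k ≥ 4 this leaves her closed neighbourhood.
escape-succ : ∀ {k x} → 4 ≤ k → suc x < k → Escape k x (suc x)
escape-succ {k} {x} 4≤k x+1<k with suc (suc x) ℕₚ.≟ k
... | no x+2≢k = suc (suc x) , ℕₚ.≤∧≢⇒< x+1<k x+2≢k , inj₂ (inj₁ refl) , λ where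
  (inj₁ ())
  (inj₂ (inj₁ ()))
  (inj₂ (inj₂ (inj₁ ())))
  (inj₂ (inj₂ (inj₂ (inj₁ (refl , refl))))) → contradiction 4≤k λ { (s≤s (s≤s (s≤s ()))) }
  (inj₂ (inj₂ (inj₂ (inj₂ (() , _)))))
... | yes refl = 0 , s≤s z≤n , inj₂ (inj₂ (inj₂ (inj₂ (refl , refl)))) , λ where
  (inj₁ refl) → contradiction 4≤k λ { (s≤s (s≤s ())) }
  (inj₂ (inj₁ ()))
  (inj₂ (inj₂ (inj₁ refl))) → contradiction 4≤k λ { (s≤s (s≤s (s≤s ()))) }
  (inj₂ (inj₂ (inj₂ (inj₁ (refl , ())))))
  (inj₂ (inj₂ (inj₂ (inj₂ (_ , ())))))

escape-pred : ∀ {k y} → 4 ≤ k → y < k → Escape k (suc y) y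
escape-pred {k} {suc y} 4≤k y+1<k = y , ℕₚ.<-trans (ℕₚ.n<1+n y) y+1<k , inj₂ (inj₂ (inj₁ refl)) , λ where
  (inj₁ ())
  (inj₂ (inj₁ ()))
  (inj₂ (inj₂ (inj₁ ())))
  (inj₂ (inj₂ (inj₂ (inj₁ (() , _)))))
  (inj₂ (inj₂ (inj₂ (inj₂ (refl , refl))))) → contradiction 4≤k λ { (s≤s (s≤s (s≤s ()))) }
escape-pred {suc k} {zero} (s≤s 3≤k) _ = k , ℕₚ.≤-refl , inj₂ (inj₂ (inj₂ (inj₁ (refl , refl)))) , λ where
  (inj₁ refl) → contradiction 3≤k λ { (s≤s ()) }
  (inj₂ (inj₁ refl)) → contradiction 3≤k λ { (s≤s (s≤s ())) }
  (inj₂ (inj₂ (inj₁ refl))) → contradiction 3≤k λ ()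
  (inj₂ (inj₂ (inj₂ (inj₁ (() , _)))))
  (inj₂ (inj₂ (inj₂ (inj₂ (refl , _))))) → contradiction 3≤k λ ()

escape-wrap-pred : ∀ {k y} → 4 ≤ k → suc y ≡ k → Escape k 0 y
escape-wrap-pred {y = suc y} (s≤s (s≤s 2≤y)) refl =
  y , ℕₚ.m≤n⇒m≤1+n (ℕₚ.n<1+n y) , inj₂ (inj₂ (inj₁ refl)) , λ where
  (inj₁ refl) → contradiction 2≤y λ ()
  (inj₂ (inj₁ refl)) → contradiction 2≤y λ { (s≤s ()) }
  (inj₂ (inj₂ (inj₁ ())))
  (inj₂ (inj₂ (inj₂ (inj₁ (_ , ())))))
  (inj₂ (inj₂ (inj₂ (inj₂ (refl , _))))) → contradiction 2≤y λ ()

escape-wrap-succ : ∀ {k x} → 4 ≤ k → suc x ≡ k → Escape k x 0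
escape-wrap-succ (s≤s 3≤x) refl = 1 , s≤s (ℕₚ.≤-trans (s≤s z≤n) 3≤x) , inj₂ (inj₁ refl) , λ where
  (inj₁ refl) → contradiction 3≤x λ { (s≤s ()) }
  (inj₂ (inj₁ refl)) → contradiction 3≤x λ ()
  (inj₂ (inj₂ (inj₁ refl))) → contradiction 3≤x λ { (s≤s (s≤s ())) }
  (inj₂ (inj₂ (inj₂ (inj₁ (refl , _))))) → contradiction 3≤x λ ()
  (inj₂ (inj₂ (inj₂ (inj₂ (() , _)))))

cycle-escape : ∀ {k x y} → 4 ≤ k → y < k → x ≢ y → Escape k x y
cycle-escape {k} {x} {y} 4≤k y<k x≢y with CycAdjℕ? k x y
... | no ¬adj                               = y , y<k , inj₁ refl , [ x≢y , ¬adj ]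
... | yes (inj₁ refl)                       = escape-succ 4≤k y<k
... | yes (inj₂ (inj₁ refl))                = escape-pred 4≤k y<k
... | yes (inj₂ (inj₂ (inj₁ (refl , y+1≡k)))) = escape-wrap-pred 4≤k y+1≡k
... | yes (inj₂ (inj₂ (inj₂ (refl , x+1≡k)))) = escape-wrap-succ 4≤k x+1≡k

cycle-start : ∀ {k} x → 4 ≤ k → Σ ℕ λ y → y < k × ¬ CycNbrℕ k x y
cycle-start zero    4≤k with cycle-escape {y = 1} 4≤k (ℕₚ.≤-trans (s≤s (s≤s z≤n)) 4≤k) (λ ())
... | y , y<k , _ , ¬0~y = y , y<k , ¬0~y
cycle-start (suc x) 4≤k with cycle-escape {y = 0} 4≤k (ℕₚ.≤-trans (s≤s z≤n) 4≤k) (λ ())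
... | y , y<k , _ , ¬x~y = y , y<k , ¬x~y

Consecutive : ℕ → ℕ → Set
Consecutive i j = suc i ≡ j ⊎ suc j ≡ i

CycAdjℕ-sym : ∀ {k x y} → CycAdjℕ k x y → CycAdjℕ k y x
CycAdjℕ-sym (inj₁ x+1≡y)                = inj₂ (inj₁ x+1≡y)
CycAdjℕ-sym (inj₂ (inj₁ y+1≡x))         = inj₁ y+1≡x
CycAdjℕ-sym (inj₂ (inj₂ (inj₁ wrap)))   = inj₂ (inj₂ (inj₂ wrap))
CycAdjℕ-sym (inj₂ (inj₂ (inj₂ wrap)))   = inj₂ (inj₂ (inj₁ wrap))

CycAdjℕ-suc-suc : ∀ {k i j} → CycAdjℕ k (suc i) (suc j) ⇔ Consecutive i j
CycAdjℕ-suc-suc = mk⇔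
  (λ { (inj₁ eq) → inj₁ (ℕₚ.suc-injective eq)
     ; (inj₂ (inj₁ eq)) → inj₂ (ℕₚ.suc-injective eq)
     ; (inj₂ (inj₂ (inj₁ (() , _))))
     ; (inj₂ (inj₂ (inj₂ (() , _)))) })
  (λ { (inj₁ eq) → inj₁ (≡.cong suc eq) ; (inj₂ eq) → inj₂ (inj₁ (≡.cong suc eq)) })

CycAdjℕ-zero-suc : ∀ {L j} → CycAdjℕ (suc (suc L)) 0 (suc j) ⇔ (j ≡ 0 ⊎ j ≡ L)
CycAdjℕ-zero-suc = mk⇔
  (λ { (inj₁ eq) → inj₁ (≡.sym (ℕₚ.suc-injective eq))
     ; (inj₂ (inj₁ ()))
     ; (inj₂ (inj₂ (inj₁ (_ , eq)))) → inj₂ (ℕₚ.suc-injective (ℕₚ.suc-injective eq))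
     ; (inj₂ (inj₂ (inj₂ (() , _)))) })
  (λ { (inj₁ refl) → inj₁ refl ; (inj₂ refl) → inj₂ (inj₂ (inj₁ (refl , refl))) })

module _ {n : ℕ} (G : Graph n) where

  Edge-sym : ∀ {u v} → Edge G u v → Edge G v u
  Edge-sym {u} {v} e = ≡.trans (sym G v u) e

  Edge-irrefl : ∀ {u} → ¬ Edge G u u
  Edge-irrefl {u} e with ≡.trans (≡.sym e) (irref G u)
  ... | ()

  Edge⇒≢ : ∀ {u v} → Edge G u v → u ≢ v
  Edge⇒≢ e refl = Edge-irrefl e

  Edge? : ∀ u v → Dec (Edge G u v)
  Edge? u v = adj G u v Bool.≟ Bool.true

  ClosedNbr-refl : ∀ {u} → ClosedNbr G u u
  ClosedNbr-refl = inj₁ refl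

  ClosedNbr-sym : ∀ {u v} → ClosedNbr G u v → ClosedNbr G v u
  ClosedNbr-sym (inj₁ u≡v) = inj₁ (≡.sym u≡v)
  ClosedNbr-sym (inj₂ e)   = inj₂ (Edge-sym e)

  ClosedNbr? : ∀ u v → Dec (ClosedNbr G u v)
  ClosedNbr? u v = (u Finₚ.≟ v) ⊎-dec Edge? u v

  Reach-start : ∀ {S u w} → Reach G S u w → u ∈ S
  Reach-start (here u∈)     = u∈
  Reach-start (step u∈ _ _) = u∈

  Reach-end : ∀ {S u w} → Reach G S u w → w ∈ S
  Reach-end (here w∈)    = w∈
  Reach-end (step _ _ r) = Reach-end r

  Reach-trans : ∀ {S u v w} → Reach G S u v → Reach G S v w → Reach G S u w
  Reach-trans (here _)       r = r
  Reach-trans (step u∈ e r₁) r = step u∈ e (Reach-trans r₁ r)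

  Edge⇒Reach : ∀ {S u v} → u ∈ S → v ∈ S → Edge G u v → Reach G S u v
  Edge⇒Reach u∈ v∈ e = step u∈ e (here v∈)

  ClosedNbr⇒Reach : ∀ {S u v} → u ∈ S → v ∈ S → ClosedNbr G u v → Reach G S u v
  ClosedNbr⇒Reach u∈ _  (inj₁ refl) = here u∈
  ClosedNbr⇒Reach u∈ v∈ (inj₂ e)    = Edge⇒Reach u∈ v∈ e

  Reach-sym : ∀ {S u w} → Reach G S u w → Reach G S w u
  Reach-sym (here u∈)     = here u∈
  Reach-sym (step u∈ e r) = Reach-trans (Reach-sym r) (Edge⇒Reach (Reach-start r) u∈ (Edge-sym e))

  Reach-mono : ∀ {S T u w} → S ⊆ T → Reach G S u w → Reach G T u w
  Reach-mono S⊆T (here u∈)     = here (S⊆T u∈)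
  Reach-mono S⊆T (step u∈ e r) = step (S⊆T u∈) e (Reach-mono S⊆T r)

  CopForces⇒Reach : ∀ {S c r} → c ∈ S → r ∈ S → CopForces G S c r → Reach G S c r
  CopForces⇒Reach c∈ _  caught                        = here c∈
  CopForces⇒Reach c∈ _  (move _ c'∈ c~c' (inj₁ refl)) = ClosedNbr⇒Reach c∈ c'∈ c~c'
  CopForces⇒Reach c∈ r∈ (move _ c'∈ c~c' (inj₂ next)) =
    Reach-trans (ClosedNbr⇒Reach c∈ c'∈ c~c') (CopForces⇒Reach c'∈ r∈ (next _ r∈ ClosedNbr-refl))

  CopWin⇒Connected : ∀ {S} → CopWin G S → Connected G S
  CopWin⇒Connected (c , c∈ , wins) = (c , c∈) , λ u v u∈ v∈ →
    Reach-trans (Reach-sym (CopForces⇒Reach c∈ u∈ (wins u u∈))) (CopForces⇒Reach c∈ v∈ (wins v v∈))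

  module _ {S : Subset n}
    (escape : ∀ {c r} → c ∈ S → r ∈ S → c ≢ r →
              ∃ λ r' → r' ∈ S × ClosedNbr G r r' × ¬ ClosedNbr G c r')
    where

    escape⇒¬CopForces : ∀ {c r} → c ∈ S → r ∈ S → ¬ ClosedNbr G c r → ¬ CopForces G S c r
    escape⇒¬CopForces _  _  c≁r caught                        = c≁r ClosedNbr-refl
    escape⇒¬CopForces _  _  c≁r (move _ _ c~c' (inj₁ refl))   = c≁r c~c'
    escape⇒¬CopForces _  r∈ c≁r (move _ c'∈ c~c' (inj₂ next)) with escape c'∈ r∈ (λ { refl → c≁r c~c' })
    ... | r' , r'∈ , r~r' , c'≁r' = escape⇒¬CopForces c'∈ r'∈ c'≁r' (next r' r'∈ r~r')

    escape⇒¬CopWin : (∀ {c} → c ∈ S → ∃ λ r → r ∈ S × ¬ ClosedNbr G c r) → ¬ CopWin G S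
    escape⇒¬CopWin start (c , c∈ , wins) with start c∈
    ... | r , r∈ , c≁r = escape⇒¬CopForces c∈ r∈ c≁r (wins r r∈)

  module _ {k : ℕ} (4≤k : 4 ≤ k) (C : InducedCycle G k) where

    private
      f : Fin k → Fin n
      f = proj₁ C

      onCycle? : ∀ v → Dec (∃ λ i → f i ≡ v)
      onCycle? v = Finₚ.any? (λ i → f i Finₚ.≟ v)

    cycleVertices : Subset n
    cycleVertices = select onCycle?

    ∈-cycleVertices⁺ : ∀ i → f i ∈ cycleVertices
    ∈-cycleVertices⁺ i = ∈-select⁺ onCycle? (i , refl)

    ∈-cycleVertices⁻ : ∀ {v} → v ∈ cycleVertices → ∃ λ i → f i ≡ v
    ∈-cycleVertices⁻ = ∈-select⁻ onCycle?

    cycle-ClosedNbr⇒ : ∀ {i j} → ClosedNbr G (f i) (f j) → CycNbrℕ k (toℕ i) (toℕ j)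
    cycle-ClosedNbr⇒     (inj₁ fi≡fj) = inj₁ (≡.cong toℕ (proj₁ (proj₂ C) fi≡fj))
    cycle-ClosedNbr⇒ {i} {j} (inj₂ e) = inj₂ (Equivalence.to (proj₂ (proj₂ C) i j) e)

    cycle-ClosedNbr⇐ : ∀ {i j} → CycNbrℕ k (toℕ i) (toℕ j) → ClosedNbr G (f i) (f j)
    cycle-ClosedNbr⇐         (inj₁ i≡j) = inj₁ (≡.cong f (Finₚ.toℕ-injective i≡j))
    cycle-ClosedNbr⇐ {i} {j} (inj₂ adj) = inj₂ (Equivalence.from (proj₂ (proj₂ C) i j) adj)

    cycle-escape-Fin : ∀ (a b : Fin k) → a ≢ b →
                       ∃ λ (b' : Fin k) → CycNbrℕ k (toℕ b) (toℕ b') × ¬ CycNbrℕ k (toℕ a) (toℕ b')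
    cycle-escape-Fin a b a≢b with cycle-escape 4≤k (Finₚ.toℕ<n b) (a≢b ∘ Finₚ.toℕ-injective)
    ... | y , y<k , b~y , a≁y rewrite ≡.sym (Finₚ.toℕ-fromℕ< y<k) = fromℕ< y<k , b~y , a≁y

    cycle-start-Fin : ∀ (a : Fin k) → ∃ λ (b : Fin k) → ¬ CycNbrℕ k (toℕ a) (toℕ b)
    cycle-start-Fin a with cycle-start (toℕ a) 4≤k
    ... | y , y<k , a≁y rewrite ≡.sym (Finₚ.toℕ-fromℕ< y<k) = fromℕ< y<k , a≁y

    cycle-¬CopWin : ¬ CopWin G cycleVertices
    cycle-¬CopWin = escape⇒¬CopWin escape start
      where
      escape : ∀ {c r} → c ∈ cycleVertices → r ∈ cycleVertices → c ≢ r →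
               ∃ λ r' → r' ∈ cycleVertices × ClosedNbr G r r' × ¬ ClosedNbr G c r'
      escape c∈ r∈ c≢r with ∈-cycleVertices⁻ c∈ | ∈-cycleVertices⁻ r∈
      ... | a , refl | b , refl with cycle-escape-Fin a b (c≢r ∘ ≡.cong f)
      ... | b' , b~b' , a≁b' = f b' , ∈-cycleVertices⁺ b' , cycle-ClosedNbr⇐ b~b' , a≁b' ∘ cycle-ClosedNbr⇒

      start : ∀ {c} → c ∈ cycleVertices → ∃ λ r → r ∈ cycleVertices × ¬ ClosedNbr G c r
      start c∈ with ∈-cycleVertices⁻ c∈
      ... | a , refl with cycle-start-Fin a
      ... | b , a≁b = f b , ∈-cycleVertices⁺ b , a≁b ∘ cycle-ClosedNbr⇒

    private
      origin : Fin k
      origin = fromℕ< (ℕₚ.≤-trans (s≤s z≤n) 4≤k)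

    cycle-reach : ∀ m {i} → toℕ i ≡ m → Reach G cycleVertices (f origin) (f i)
    cycle-reach zero {i} i≡0 = ClosedNbr⇒Reach (∈-cycleVertices⁺ origin) (∈-cycleVertices⁺ i)
      (cycle-ClosedNbr⇐ (inj₁ (≡.trans (Finₚ.toℕ-fromℕ< _) (≡.sym i≡0))))
    cycle-reach (suc m) {i} i≡1+m = Reach-trans (cycle-reach m (Finₚ.toℕ-fromℕ< m<k))
      (ClosedNbr⇒Reach (∈-cycleVertices⁺ _) (∈-cycleVertices⁺ i)
        (cycle-ClosedNbr⇐ (inj₂ (inj₁ (≡.trans (≡.cong suc (Finₚ.toℕ-fromℕ< m<k)) (≡.sym i≡1+m))))))
      where
      m<k : m < k
      m<k = ℕₚ.<-trans (ℕₚ.n<1+n m) (≡.subst (_< k) i≡1+m (Finₚ.toℕ<n i))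

    cycle-Connected : Connected G cycleVertices
    cycle-Connected = (f origin , ∈-cycleVertices⁺ origin) ,
                      λ u v u∈ v∈ → reach (∈-cycleVertices⁻ u∈) (∈-cycleVertices⁻ v∈)
      where
      reach : ∀ {u v} → ∃ (λ i → f i ≡ u) → ∃ (λ j → f j ≡ v) → Reach G cycleVertices u v
      reach (i , refl) (j , refl) = Reach-trans (Reach-sym (cycle-reach _ refl)) (cycle-reach _ refl)

  Dominates : Subset n → Fin n → Fin n → Set
  Dominates S v u = ∀ t → t ∈ S → ClosedNbr G u t → ClosedNbr G v t

  CopForces-adjacent : ∀ {S c r} → r ∈ S → ClosedNbr G c r → CopForces G S c r
  CopForces-adjacent _  (inj₁ refl) = caught
  CopForces-adjacent r∈ c~r         = move _ r∈ c~r (inj₁ refl)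

  Reach-map : ∀ {S T} (φ : Fin n → Fin n) → (∀ {x} → x ∈ S → φ x ∈ T) →
              (∀ {x y} → x ∈ S → y ∈ S → Edge G x y → ClosedNbr G (φ x) (φ y)) →
              ∀ {a b} → Reach G S a b → Reach G T (φ a) (φ b)
  Reach-map φ φ∈ φ~ (here a∈)     = here (φ∈ a∈)
  Reach-map φ φ∈ φ~ (step a∈ e r) =
    Reach-trans (ClosedNbr⇒Reach (φ∈ a∈) (φ∈ (Reach-start r)) (φ~ a∈ (Reach-start r) e)) (Reach-map φ φ∈ φ~ r)

  module _ {S u v} (u∈ : u ∈ S) (v∈ : v ∈ S) (u≢v : u ≢ v) (v≽u : Dominates S v u) where

    retract : Fin n → Fin n
    retract t with t Finₚ.≟ u
    ... | yes _ = v
    ... | no  _ = t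

    retract-fix : ∀ {t} → t ≢ u → retract t ≡ t
    retract-fix {t} t≢u with t Finₚ.≟ u
    ... | yes t≡u = contradiction t≡u t≢u
    ... | no  _   = refl

    retract-∈ : ∀ {t} → t ∈ S → retract t ∈ S - u
    retract-∈ {t} t∈ with t Finₚ.≟ u
    ... | yes _   = Subsetₚ.x∈p∧x≢y⇒x∈p-y v∈ (u≢v ∘ ≡.sym)
    ... | no  t≢u = Subsetₚ.x∈p∧x≢y⇒x∈p-y t∈ t≢u

    retract-dominates : ∀ {x y} → y ∈ S → ClosedNbr G x y → ClosedNbr G (retract x) y
    retract-dominates {x} y∈ x~y with x Finₚ.≟ u
    ... | yes refl = v≽u _ y∈ x~y
    ... | no  _    = x~y

    retract-hom : ∀ {x y} → x ∈ S → y ∈ S → ClosedNbr G x y → ClosedNbr G (retract x) (retract y)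
    retract-hom x∈ y∈ x~y = ClosedNbr-sym (retract-dominates (p-x⊆p S u (retract-∈ x∈))
                                                             (ClosedNbr-sym (retract-dominates y∈ x~y)))

    Connected-remove-dominated : Connected G S → Connected G (S - u)
    Connected-remove-dominated (_ , reach) =
      (v , Subsetₚ.x∈p∧x≢y⇒x∈p-y v∈ (u≢v ∘ ≡.sym)) , λ a b a∈ b∈ →
      ≡.subst₂ (Reach G (S - u)) (retract-fix (x∈p-y⇒x≢y a∈)) (retract-fix (x∈p-y⇒x≢y b∈))
        (Reach-map retract retract-∈ (λ x∈ y∈ e → retract-hom x∈ y∈ (inj₂ e))
                   (reach a b (p-x⊆p S u a∈) (p-x⊆p S u b∈)))

    -- The cop plays against the robber's shadow retract r; catching the shadow puts her next to him.
    shadow-strategy : ∀ {c r₀} → CopForces G (S - u) c r₀ →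
                      ∀ {r} → r ∈ S → retract r ≡ r₀ → CopForces G S c r
    shadow-strategy caught r∈ refl = CopForces-adjacent r∈ (retract-dominates r∈ ClosedNbr-refl)
    shadow-strategy (move c' c'∈ c~c' (inj₁ refl)) r∈ refl =
      move c' (p-x⊆p S u c'∈) c~c' (inj₂ λ r' r'∈ r~r' →
        CopForces-adjacent r'∈ (retract-dominates r'∈ r~r'))
    shadow-strategy (move c' c'∈ c~c' (inj₂ next)) r∈ refl =
      move c' (p-x⊆p S u c'∈) c~c' (inj₂ λ r' r'∈ r~r' →
        shadow-strategy (next (retract r') (retract-∈ r'∈) (retract-hom r∈ r'∈ r~r')) r'∈ refl)

    CopWin-add-dominated : CopWin G (S - u) → CopWin G S
    CopWin-add-dominated (c , c∈ , wins) =
      c , p-x⊆p S u c∈ , λ r r∈ → shadow-strategy (wins (retract r) (retract-∈ r∈)) r∈ refl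

  Reach-last-visit : ∀ {D v w} u → Reach G D v w →
    Reach G (D - u) v w ⊎ u ≡ w ⊎ ∃ λ v' → v' ∈ D × Edge G u v' × Reach G (D - u) v' w
  Reach-last-visit u (here {v} v∈) with v Finₚ.≟ u
  ... | yes refl = inj₂ (inj₁ refl)
  ... | no  v≢u  = inj₁ (here (Subsetₚ.x∈p∧x≢y⇒x∈p-y v∈ v≢u))
  Reach-last-visit u (step {v} v∈ e r) with Reach-last-visit u r
  ... | inj₂ later = inj₂ later
  ... | inj₁ r' with v Finₚ.≟ u
  ...   | yes refl = inj₂ (inj₂ (_ , Reach-start r , e , r'))
  ...   | no  v≢u  = inj₁ (step (Subsetₚ.x∈p∧x≢y⇒x∈p-y v∈ v≢u) e r')

  Reach?-acc : ∀ D → Acc _<_ ∣ D ∣ → ∀ u w → Dec (Reach G D u w)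
  Reach?-acc D (acc smaller) u w with u Subsetₚ.∈? D | u Finₚ.≟ w
  ... | no  u∉D | _        = no (u∉D ∘ Reach-start)
  ... | yes u∈D | yes refl = yes (here u∈D)
  ... | yes u∈D | no  u≢w
    with Finₚ.any? (λ v → (v Subsetₚ.∈? D) ×-dec Edge? u v ×-dec
                          Reach?-acc (D - u) (smaller (Subsetₚ.x∈p⇒∣p-x∣<∣p∣ u∈D)) v w)
  ...   | yes (_ , _ , e , r) = yes (step u∈D e (Reach-mono (p-x⊆p D u) r))
  ...   | no  ¬onward = no λ where
          (here _)     → u≢w refl
          (step _ e r) → [ (λ r' → ¬onward (_ , Reach-start r , e , r')) , [ u≢w , ¬onward ] ]
                           (Reach-last-visit u r)

  Reach? : ∀ D u w → Dec (Reach G D u w)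
  Reach? D = Reach?-acc D (<-wellFounded ∣ D ∣)

  -- InducedPath u w vs: an induced path from u to w whose vertices after u are vs.
  data InducedPath : Fin n → Fin n → List (Fin n) → Set where
    stop : ∀ {u} → InducedPath u u []
    edge : ∀ {u v w vs} → Edge G u v → All (¬_ ∘ ClosedNbr G u) vs → InducedPath v w vs →
           InducedPath u w (v ∷ vs)

  InducedPath-prepend : ∀ {P : Fin n → Set} {u v w vs} → InducedPath v w vs →
    Any (ClosedNbr G u) (v ∷ vs) → P u → All P (v ∷ vs) → ∃ λ vs' → InducedPath u w vs' × All P vs'
  InducedPath-prepend {u = u} {vs = vs} p u~ Pu (Pv ∷ Pvs) with Any.any? (ClosedNbr? u) vs
  InducedPath-prepend (edge _ _ p) _ Pu (_ ∷ Pvs) | yes u~later = InducedPath-prepend p u~later Pu Pvs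
  InducedPath-prepend _ (Any.there u~later)  _ _ | no ¬u~later = contradiction u~later ¬u~later
  InducedPath-prepend {vs = vs} p (Any.here (inj₁ refl)) _ (_ ∷ Pvs) | no _ = vs , p , Pvs
  InducedPath-prepend {v = v} {vs = vs} p (Any.here (inj₂ e)) _ Pvs | no ¬u~later =
    v ∷ vs , edge e (¬Any⇒All¬ vs ¬u~later) p , Pvs

  Reach⇒InducedPath : ∀ {D u w} → Reach G D u w → ∃ λ vs → InducedPath u w vs × All (_∈ D) vs
  Reach⇒InducedPath (here _) = [] , stop , []
  Reach⇒InducedPath (step u∈ e r) with Reach⇒InducedPath r
  ... | _ , p , vs∈D = InducedPath-prepend p (Any.here (inj₂ e)) u∈ (Reach-start r ∷ vs∈D)


  InducedPath-lookup-injective : ∀ {a b vs} → InducedPath a b vs → ∀ i j →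
    lookup (a ∷ vs) i ≡ lookup (a ∷ vs) j → i ≡ j
  InducedPath-lookup-injective _             zero          zero          _  = refl
  InducedPath-lookup-injective (edge e _ _)  zero          (suc zero)    eq = contradiction eq (Edge⇒≢ e)
  InducedPath-lookup-injective (edge _ a≁ _) zero          (suc (suc j)) eq =
    contradiction (inj₁ eq) (All.lookup a≁ (∈-lookup j))
  InducedPath-lookup-injective (edge e _ _)  (suc zero)    zero          eq = contradiction (≡.sym eq) (Edge⇒≢ e)
  InducedPath-lookup-injective (edge _ a≁ _) (suc (suc i)) zero          eq =
    contradiction (inj₁ (≡.sym eq)) (All.lookup a≁ (∈-lookup i))
  InducedPath-lookup-injective (edge _ _ p)  (suc i)       (suc j)       eq =
    ≡.cong suc (InducedPath-lookup-injective p i j eq)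

  InducedPath-lookup-last : ∀ {a b vs} → InducedPath a b vs → lookup (a ∷ vs) (Fin.fromℕ (length vs)) ≡ b
  InducedPath-lookup-last stop         = refl
  InducedPath-lookup-last (edge _ _ p) = InducedPath-lookup-last p

  InducedPath-Edge⇒Consecutive : ∀ {a b vs} → InducedPath a b vs → ∀ i j →
    Edge G (lookup (a ∷ vs) i) (lookup (a ∷ vs) j) → Consecutive (toℕ i) (toℕ j)
  InducedPath-Edge⇒Consecutive _             zero          zero          e = contradiction e Edge-irrefl
  InducedPath-Edge⇒Consecutive (edge _ _ _)  zero          (suc zero)    _ = inj₁ refl
  InducedPath-Edge⇒Consecutive (edge _ a≁ _) zero          (suc (suc j)) e =
    contradiction (inj₂ e) (All.lookup a≁ (∈-lookup j))
  InducedPath-Edge⇒Consecutive (edge _ _ _)  (suc zero)    zero          _ = inj₂ refl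
  InducedPath-Edge⇒Consecutive (edge _ a≁ _) (suc (suc i)) zero          e =
    contradiction (inj₂ (Edge-sym e)) (All.lookup a≁ (∈-lookup i))
  InducedPath-Edge⇒Consecutive (edge _ _ p)  (suc i)       (suc j)       e =
    Sum.map (≡.cong suc) (≡.cong suc) (InducedPath-Edge⇒Consecutive p i j e)

  InducedPath-Consecutive⇒Edge : ∀ {a b vs} → InducedPath a b vs → ∀ i j →
    Consecutive (toℕ i) (toℕ j) → Edge G (lookup (a ∷ vs) i) (lookup (a ∷ vs) j)
  InducedPath-Consecutive⇒Edge (edge e _ _) zero          (suc zero)    _ = e
  InducedPath-Consecutive⇒Edge (edge e _ _) (suc zero)    zero          _ = Edge-sym e
  InducedPath-Consecutive⇒Edge (edge _ _ p) (suc i)       (suc j)       c =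
    InducedPath-Consecutive⇒Edge p i j (Sum.map ℕₚ.suc-injective ℕₚ.suc-injective c)
  InducedPath-Consecutive⇒Edge _            zero          zero          (inj₁ ())
  InducedPath-Consecutive⇒Edge _            zero          zero          (inj₂ ())
  InducedPath-Consecutive⇒Edge (edge _ _ _) zero          (suc (suc _)) (inj₁ ())
  InducedPath-Consecutive⇒Edge (edge _ _ _) zero          (suc (suc _)) (inj₂ ())
  InducedPath-Consecutive⇒Edge (edge _ _ _) (suc (suc _)) zero          (inj₁ ())
  InducedPath-Consecutive⇒Edge (edge _ _ _) (suc (suc _)) zero          (inj₂ ())

  InducedPath-long : ∀ {a b vs} → InducedPath a b vs → a ≢ b → ¬ Edge G a b → 2 ≤ length vs
  InducedPath-long stop                       a≢b _   = contradiction refl a≢b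
  InducedPath-long (edge e _ stop)            _   a≁b = contradiction e a≁b
  InducedPath-long (edge _ _ (edge _ _ _))    _   _   = s≤s (s≤s z≤n)

  module _ {x a b vs} (p : InducedPath a b vs) (x~a : Edge G x a) (x~b : Edge G x b)
           (x≁inner : All (λ t → ¬ ClosedNbr G x t ⊎ t ≡ a ⊎ t ≡ b) vs) where

    private
      L : ℕ
      L = length vs

      vertex : Fin (suc L) → Fin n
      vertex = lookup (a ∷ vs)

      vertex≡b⇒last : ∀ j → vertex j ≡ b → toℕ j ≡ L
      vertex≡b⇒last j eq = ≡.trans
        (≡.cong toℕ (InducedPath-lookup-injective p j (Fin.fromℕ L) (≡.trans eq (≡.sym (InducedPath-lookup-last p)))))
        (Finₚ.toℕ-fromℕ L)

      last⇒vertex≡b : ∀ j → toℕ j ≡ L → vertex j ≡ b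
      last⇒vertex≡b j eq = ≡.trans
        (≡.cong vertex (Finₚ.toℕ-injective (≡.trans eq (≡.sym (Finₚ.toℕ-fromℕ L)))))
        (InducedPath-lookup-last p)

      inner≢a : ∀ j → vertex (suc j) ≢ a
      inner≢a j eq with InducedPath-lookup-injective p (suc j) zero eq
      ... | ()

    apex-≢ : ∀ j → x ≢ vertex j
    apex-≢ zero = Edge⇒≢ x~a
    apex-≢ (suc j) with All.lookup x≁inner (∈-lookup j)
    ... | inj₁ x≁       = x≁ ∘ inj₁
    ... | inj₂ (inj₁ eq) = contradiction eq (inner≢a j)
    ... | inj₂ (inj₂ eq) = λ x≡ → Edge⇒≢ x~b (≡.trans x≡ eq)

    apex-Edge⇒end : ∀ j → Edge G x (vertex j) → toℕ j ≡ 0 ⊎ toℕ j ≡ L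
    apex-Edge⇒end zero    _ = inj₁ refl
    apex-Edge⇒end (suc j) e with All.lookup x≁inner (∈-lookup j)
    ... | inj₁ x≁       = contradiction (inj₂ e) x≁
    ... | inj₂ (inj₁ eq) = contradiction eq (inner≢a j)
    ... | inj₂ (inj₂ eq) = inj₂ (vertex≡b⇒last (suc j) eq)

    apex-end⇒Edge : ∀ j → toℕ j ≡ 0 ⊎ toℕ j ≡ L → Edge G x (vertex j)
    apex-end⇒Edge zero    (inj₁ _)  = x~a
    apex-end⇒Edge (suc j) (inj₁ ())
    apex-end⇒Edge j       (inj₂ eq) = ≡.subst (Edge G x) (≡.sym (last⇒vertex≡b j eq)) x~b

    closeCycle-injective : ∀ {i j} → lookup (x ∷ a ∷ vs) i ≡ lookup (x ∷ a ∷ vs) j → i ≡ j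
    closeCycle-injective {zero}  {zero}  _  = refl
    closeCycle-injective {zero}  {suc j} eq = contradiction eq (apex-≢ j)
    closeCycle-injective {suc i} {zero}  eq = contradiction (≡.sym eq) (apex-≢ i)
    closeCycle-injective {suc i} {suc j} eq = ≡.cong suc (InducedPath-lookup-injective p i j eq)

    closeCycle-Edge⇒ : ∀ i j → Edge G (lookup (x ∷ a ∷ vs) i) (lookup (x ∷ a ∷ vs) j) →
                       CycAdjℕ (suc (suc L)) (toℕ i) (toℕ j)
    closeCycle-Edge⇒ zero    zero    e = contradiction e Edge-irrefl
    closeCycle-Edge⇒ zero    (suc j) e = Equivalence.from CycAdjℕ-zero-suc (apex-Edge⇒end j e)
    closeCycle-Edge⇒ (suc i) zero    e = CycAdjℕ-sym (Equivalence.from CycAdjℕ-zero-suc (apex-Edge⇒end i (Edge-sym e)))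
    closeCycle-Edge⇒ (suc i) (suc j) e = Equivalence.from CycAdjℕ-suc-suc (InducedPath-Edge⇒Consecutive p i j e)

    closeCycle-Edge⇐ : ∀ i j → CycAdjℕ (suc (suc L)) (toℕ i) (toℕ j) →
                       Edge G (lookup (x ∷ a ∷ vs) i) (lookup (x ∷ a ∷ vs) j)
    closeCycle-Edge⇐ zero    zero    (inj₁ ())
    closeCycle-Edge⇐ zero    zero    (inj₂ (inj₁ ()))
    closeCycle-Edge⇐ zero    zero    (inj₂ (inj₂ (inj₁ (_ , ()))))
    closeCycle-Edge⇐ zero    zero    (inj₂ (inj₂ (inj₂ (_ , ()))))
    closeCycle-Edge⇐ zero    (suc j) c = apex-end⇒Edge j (Equivalence.to CycAdjℕ-zero-suc c)
    closeCycle-Edge⇐ (suc i) zero    c = Edge-sym (apex-end⇒Edge i (Equivalence.to CycAdjℕ-zero-suc (CycAdjℕ-sym c)))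
    closeCycle-Edge⇐ (suc i) (suc j) c = InducedPath-Consecutive⇒Edge p i j (Equivalence.to CycAdjℕ-suc-suc c)

    closeCycle : InducedCycle G (suc (suc L))
    closeCycle = lookup (x ∷ a ∷ vs) , closeCycle-injective ,
                 λ i j → mk⇔ (closeCycle-Edge⇒ i j) (closeCycle-Edge⇐ i j)

  Simplicial : Subset n → Fin n → Set
  Simplicial T z = z ∈ T × (∀ a b → a ∈ T → b ∈ T → ClosedNbr G z a → ClosedNbr G z b → ClosedNbr G a b)

  NonUniversal : Subset n → Fin n → Set
  NonUniversal T x = ∃ λ y → y ∈ T × ¬ ClosedNbr G x y

  NonUniversal? : ∀ T x → Dec (NonUniversal T x)
  NonUniversal? T x = Finₚ.any? (λ y → (y Subsetₚ.∈? T) ×-dec ¬? (ClosedNbr? x y))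

  ¬NonUniversal⇒ClosedNbr : ∀ {T x} → ¬ NonUniversal T x → ∀ {y} → y ∈ T → ClosedNbr G x y
  ¬NonUniversal⇒ClosedNbr {T} {x} ¬nu {y} y∈T with ClosedNbr? x y
  ... | yes x~y = x~y
  ... | no  x≁y = contradiction (y , y∈T , x≁y) ¬nu

  Simplicial⇒Dominates : ∀ {T z w} → Simplicial T z → w ∈ T → Edge G z w → Dominates T w z
  Simplicial⇒Dominates (_ , clique) w∈ z~w t t∈ z~t = clique _ t w∈ t∈ (inj₂ z~w) z~t

  module Separation {T : Subset n} {x y : Fin n} (y∈T : y ∈ T) (x≁y : ¬ ClosedNbr G x y) where

    private
      far? : ∀ t → Dec (t ∈ T × ¬ ClosedNbr G x t)
      far? t = (t Subsetₚ.∈? T) ×-dec ¬? (ClosedNbr? x t)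

    far : Subset n
    far = select far?

    component : Subset n
    component = select (Reach? far y)

    private
      near? : ∀ t → Dec (t ∈ T × ∃ λ c → c ∈ component × ClosedNbr G c t)
      near? t = (t Subsetₚ.∈? T) ×-dec Finₚ.any? (λ c → (c Subsetₚ.∈? component) ×-dec ClosedNbr? c t)

    neighbourhood : Subset n
    neighbourhood = select near?

    far⁻ : ∀ {t} → t ∈ far → t ∈ T × ¬ ClosedNbr G x t
    far⁻ = ∈-select⁻ far?

    component-reach : ∀ {c c'} → c ∈ component → c' ∈ component → Reach G far c c'
    component-reach c∈ c'∈ = Reach-trans (Reach-sym (∈-select⁻ (Reach? far y) c∈)) (∈-select⁻ (Reach? far y) c'∈)

    component⊆far : ∀ {c} → c ∈ component → c ∈ far
    component⊆far c∈ = Reach-end (∈-select⁻ (Reach? far y) c∈)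

    y∈component : y ∈ component
    y∈component = ∈-select⁺ (Reach? far y) (here (∈-select⁺ far? (y∈T , x≁y)))

    neighbourhood⁺ : ∀ {c t} → t ∈ T → c ∈ component → ClosedNbr G c t → t ∈ neighbourhood
    neighbourhood⁺ t∈T c∈ c~t = ∈-select⁺ near? (t∈T , _ , c∈ , c~t)

    neighbourhood⁻ : ∀ {t} → t ∈ neighbourhood → t ∈ T × ∃ λ c → c ∈ component × ClosedNbr G c t
    neighbourhood⁻ = ∈-select⁻ near?

    component⊆neighbourhood : ∀ {c} → c ∈ component → c ∈ neighbourhood
    component⊆neighbourhood c∈ = neighbourhood⁺ (proj₁ (far⁻ (component⊆far c∈))) c∈ ClosedNbr-refl

    x∉neighbourhood : x ∉ neighbourhood
    x∉neighbourhood x∈ with neighbourhood⁻ x∈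
    ... | _ , c , c∈ , c~x = proj₂ (far⁻ (component⊆far c∈)) (ClosedNbr-sym c~x)

    ∣neighbourhood∣<∣T∣ : x ∈ T → ∣ neighbourhood ∣ < ∣ T ∣
    ∣neighbourhood∣<∣T∣ x∈T = Subsetₚ.p⊂q⇒∣p∣<∣q∣ (proj₁ ∘ neighbourhood⁻ , x , x∈T , x∉neighbourhood)

    boundary-Edge-apex : ∀ {t} → t ∈ neighbourhood → t ∉ component → Edge G x t
    boundary-Edge-apex {t} t∈ t∉ with ClosedNbr? x t | neighbourhood⁻ t∈
    ... | yes (inj₁ refl) | _ = contradiction t∈ x∉neighbourhood
    ... | yes (inj₂ e)    | _ = e
    ... | no  x≁t | t∈T , c , c∈ , c~t = contradiction
          (∈-select⁺ (Reach? far y) (Reach-trans (∈-select⁻ (Reach? far y) c∈)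
            (ClosedNbr⇒Reach (component⊆far c∈) (∈-select⁺ far? (t∈T , x≁t)) c~t)))
          t∉

    boundary-Edge-component : ∀ {t} → t ∈ neighbourhood → t ∉ component → ∃ λ c → c ∈ component × Edge G c t
    boundary-Edge-component t∈ t∉ with neighbourhood⁻ t∈
    ... | _ , c , c∈ , inj₁ refl = contradiction c∈ t∉
    ... | _ , c , c∈ , inj₂ e    = c , c∈ , e

    simplicial-lift : ∀ {z} → z ∈ component → Simplicial neighbourhood z → Simplicial T z × ¬ ClosedNbr G x z
    simplicial-lift z∈ (_ , clique) with far⁻ (component⊆far z∈)
    ... | z∈T , x≁z = (z∈T , λ a b a∈ b∈ z~a z~b →
      clique a b (neighbourhood⁺ a∈ z∈ z~a) (neighbourhood⁺ b∈ z∈ z~b) z~a z~b) , x≁z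

    -- Non-adjacent boundary vertices a, b would be joined through the component by an induced path
    -- avoiding N[x], which x closes into an induced cycle of length at least 4.
    boundary-clique : Chordal G → ∀ {a b} → a ∈ neighbourhood → a ∉ component →
                      b ∈ neighbourhood → b ∉ component →
                      ClosedNbr G a b
    boundary-clique chordal {a} {b} a∈ a∉ b∈ b∉ with a Finₚ.≟ b | Edge? a b
    ... | yes a≡b | _     = inj₁ a≡b
    ... | no  _   | yes e = inj₂ e
    ... | no  a≢b | no a≁b = no-long-cycle (Reach⇒InducedPath walk)
      where
      D? : ∀ t → Dec (t ∈ far ⊎ t ≡ a ⊎ t ≡ b)
      D? t = (t Subsetₚ.∈? far) ⊎-dec (t Finₚ.≟ a) ⊎-dec (t Finₚ.≟ b)

      far⊆D : far ⊆ select D?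
      far⊆D t∈ = ∈-select⁺ D? (inj₁ t∈)

      walk : Reach G (select D?) a b
      walk with boundary-Edge-component a∈ a∉ | boundary-Edge-component b∈ b∉
      ... | ca , ca∈ , ca~a | cb , cb∈ , cb~b =
        step (∈-select⁺ D? (inj₂ (inj₁ refl))) (Edge-sym ca~a)
          (Reach-trans (Reach-mono far⊆D (component-reach ca∈ cb∈))
                       (Edge⇒Reach (far⊆D (component⊆far cb∈)) (∈-select⁺ D? (inj₂ (inj₂ refl))) cb~b))

      apex-far : ∀ {t} → t ∈ select D? → ¬ ClosedNbr G x t ⊎ t ≡ a ⊎ t ≡ b
      apex-far t∈ = Sum.map₁ (proj₂ ∘ far⁻) (∈-select⁻ D? t∈)

      no-long-cycle : (∃ λ vs → InducedPath a b vs × All (_∈ select D?) vs) → ClosedNbr G a b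
      no-long-cycle (vs , p , vs∈D) = contradiction
        (closeCycle p (boundary-Edge-apex a∈ a∉) (boundary-Edge-apex b∈ b∉) (All.map apex-far vs∈D))
        (chordal _ (s≤s (s≤s (InducedPath-long p a≢b a≁b))))

  Chordal⇒simplicial-nonadjacent-acc : Chordal G → ∀ T → Acc _<_ ∣ T ∣ → ∀ {x} → x ∈ T → NonUniversal T x →
                                   ∃ λ z → Simplicial T z × ¬ ClosedNbr G x z
  Chordal⇒simplicial-nonadjacent-acc chordal T (acc smaller) {x} x∈T (y , y∈T , x≁y) =
    let z , z∈C , simp = simplicial-in-component in z , simplicial-lift z∈C simp
    where
    open Separation y∈T x≁y

    recurse : ∀ {x'} → x' ∈ neighbourhood → NonUniversal neighbourhood x' →
              ∃ λ z → Simplicial neighbourhood z × ¬ ClosedNbr G x' z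
    recurse = Chordal⇒simplicial-nonadjacent-acc chordal neighbourhood (smaller (∣neighbourhood∣<∣T∣ x∈T))

    -- If the recursive simplicial vertex lies on the boundary clique, a second call avoiding it cannot.
    simplicial-in-component : ∃ λ z → z ∈ component × Simplicial neighbourhood z
    simplicial-in-component with Finₚ.any? (λ x' → (x' Subsetₚ.∈? neighbourhood) ×-dec NonUniversal? neighbourhood x')
    ... | no ¬any = y , y∈component , component⊆neighbourhood y∈component ,
          λ a b a∈ b∈ _ _ → ¬NonUniversal⇒ClosedNbr (λ nu → ¬any (a , a∈ , nu)) b∈
    ... | yes (x' , x'∈ , nu) with recurse x'∈ nu
    ...   | z , simp , x'≁z with z Subsetₚ.∈? component
    ...     | yes z∈C = z , z∈C , simp
    ...     | no  z∉C with recurse (proj₁ simp) (x' , x'∈ , x'≁z ∘ ClosedNbr-sym)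
    ...       | z' , simp' , z≁z' with z' Subsetₚ.∈? component
    ...         | yes z'∈C = z' , z'∈C , simp'
    ...         | no  z'∉C = contradiction (boundary-clique chordal (proj₁ simp) z∉C (proj₁ simp') z'∉C) z≁z'

  Chordal⇒simplicial-nonadjacent : Chordal G → ∀ {T x} → x ∈ T → NonUniversal T x →
                                   ∃ λ z → Simplicial T z × ¬ ClosedNbr G x z
  Chordal⇒simplicial-nonadjacent chordal {T} = Chordal⇒simplicial-nonadjacent-acc chordal T (<-wellFounded ∣ T ∣)

  Chordal⇒CopWin-acc : Chordal G → ∀ S → Acc _<_ ∣ S ∣ → Connected G S → CopWin G S
  Chordal⇒CopWin-acc chordal S (acc smaller) conn@((c , c∈) , reach)
    with Finₚ.any? (λ x → (x Subsetₚ.∈? S) ×-dec NonUniversal? S x)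
  ... | no ¬any =
    c , c∈ , λ r r∈ → CopForces-adjacent r∈ (¬NonUniversal⇒ClosedNbr (λ nu → ¬any (c , c∈ , nu)) r∈)
  ... | yes (x , x∈ , nu) with Chordal⇒simplicial-nonadjacent chordal x∈ nu
  ...   | z , simp , x≁z with reach z x (proj₁ simp) x∈
  ...     | here _           = contradiction ClosedNbr-refl x≁z
  ...     | step {v = w} z∈ z~w w⇝x = CopWin-add-dominated z∈ w∈ (Edge⇒≢ z~w) w≽z
            (Chordal⇒CopWin-acc chordal (S - z) (smaller (Subsetₚ.x∈p⇒∣p-x∣<∣p∣ z∈))
              (Connected-remove-dominated z∈ w∈ (Edge⇒≢ z~w) w≽z conn))
    where
    w∈ : w ∈ S
    w∈ = Reach-start w⇝x
    w≽z : Dominates S w z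
    w≽z = Simplicial⇒Dominates simp w∈ z~w

  Chordal⇒CopWin : Chordal G → ∀ {S} → Connected G S → CopWin G S
  Chordal⇒CopWin chordal {S} = Chordal⇒CopWin-acc chordal S (<-wellFounded ∣ S ∣)

½ : ℚ
½ = + 1 ℚ./ 2

lemma2p1 : (n : ℕ) (G : Graph n) (S W : ℕ → ℕ) →
    IsSCount G S → IsWCount G W →
    ((∀ (p : ℚ) → RelPoly n S p ≡ RelPoly n W p) ⇔ Chordal G)
lemma2p1 n G S W #S #W = mk⇔ equal⇒chordal chordal⇒equal
  where
  copWin⇒connected : ∀ {i} s → ∣ s ∣ ≡ i × CopWin G s → ∣ s ∣ ≡ i × Connected G s
  copWin⇒connected _ (size , copWin) = size , CopWin⇒Connected G copWin

  W≤S : ∀ i → W i ≤ S i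
  W≤S i = IsCount-mono-≤ copWin⇒connected (#W i) (#S i)

  equal⇒chordal : (∀ p → RelPoly n S p ≡ RelPoly n W p) → Chordal G
  equal⇒chordal equal k 4≤k C =
    ℚₚ.<-irrefl (≡.sym (equal ½)) (relSum-mono-< n ½ W≤S W<S 1≤∣V∣ n (Subsetₚ.∣p∣≤n V))
    where
    V : Subset n
    V = cycleVertices G 4≤k C

    W<S : W ∣ V ∣ < S ∣ V ∣
    W<S = IsCount-mono-< copWin⇒connected (refl , cycle-Connected G 4≤k C) (cycle-¬CopWin G 4≤k C ∘ proj₂)
                         (#W ∣ V ∣) (#S ∣ V ∣)

    1≤∣V∣ : 1 ≤ ∣ V ∣
    1≤∣V∣ = ℕₚ.≤-<-trans z≤n (Subsetₚ.x∈p⇒∣p-x∣<∣p∣ (proj₂ (proj₁ (cycle-Connected G 4≤k C))))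

  chordal⇒equal : Chordal G → ∀ p → RelPoly n S p ≡ RelPoly n W p
  chordal⇒equal chordal p = relSum-cong n p S≡W n
    where
    S≡W : ∀ i → S i ≡ W i
    S≡W i = ℕₚ.≤-antisym (IsCount-mono-≤ (λ _ (size , conn) → size , Chordal⇒CopWin G chordal conn) (#S i) (#W i))
                         (W≤S i)
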